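{- Let $n$ and $k$ be positive integers such that $n$ is odd and exactly $k$-deficient-perfect. Then $n$ is a perfect square if and only if $k$ is odd. In particular, every odd exactly $3$-deficient-perfect number is a perfect square.
   Context: For a positive integer $n$, $\sigma(n)$ denotes the sum of all positive divisors of $n$. For a positive integer $k$, $n$ is called exactly $k$-deficient-perfect if there exist distinct proper divisors $d_1,\dots,d_k$ of $n$ (positive divisors less than $n$) with $\sigma(n) = 2n-(d_1+d_2+\cdots+d_k)$. -}

module Defs where

open import Data.Nat using (ℕ; suc; _+_; _*_; _<_)
open import Data.Nat.Divisibility using (_∣_; _∣?_)
open import Data.List using (List; filter; upTo; length; map)
open import Data.Nat.ListAction using (sum)
open import Data.List.Relation.Unary.All using (All)
open import Data.List.Relation.Unary.Unique.Propositional using (Unique)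
open import Data.Product using (Σ; ∃; _×_)
open import Relation.Binary.PropositionalEquality using (_≡_)

σ : ℕ → ℕ
σ n = sum (filter (_∣? n) (map suc (upTo n)))

ProperDivisor : ℕ → ℕ → Set
ProperDivisor n d = (0 < d) × (d ∣ n) × (d < n)

ExactlyDeficientPerfect : ℕ → ℕ → Set
ExactlyDeficientPerfect k n =
  Σ (List ℕ) λ ds →
    (length ds ≡ k) × Unique ds × All (ProperDivisor n) ds ×
    (σ n + sum ds ≡ 2 * n)

Odd : ℕ → Set
Odd n = ∃ λ m → n ≡ 2 * m + 1

IsSquare : ℕ → Set
IsSquare n = ∃ λ m → n ≡ m * m

{-# OPTIONS --safe #-}
module Submission where

-- Every divisor of an odd n is odd, so σ(n) ≡ τ(n) and d₁ + ⋯ + d_k ≡ k (mod 2);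
-- as σ(n) + d₁ + ⋯ + d_k = 2n, this gives τ(n) ≡ k (mod 2). Counting the pairs
-- (a, b) with a b = n, those with a ≠ b come in symmetric couples, so τ(n) is
-- congruent to the number of a with a² = n: one if n is a square, none otherwise.

open import Defs
open import Data.Nat using (ℕ; zero; suc; _+_; _*_; _≤_; _<_; z≤n; s≤s; _≟_; _<?_; >-nonZero)
open import Data.Nat.Properties
open import Data.Nat.DivMod using (_%_; _/_; %-distribˡ-+; [m+kn]%n≡m%n; m*n%n≡0; m%n<n; m≡m%n+[m/n]*n)
open import Data.Nat.Divisibility using (_∣_; _∣?_; divides; ∣-trans; n∣m⇒m%n≡0; m%n≡0⇒n∣m)
open import Data.Nat.ListAction using (sum)
open import Data.Nat.ListAction.Properties using (sum-++)
open import Data.Nat.Solver using (module +-*-Solver)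
open import Data.List using (List; []; _∷_; _++_; [_]; filter; map; upTo; applyUpTo; length)
open import Data.List.Properties using (map-upTo; applyUpTo-∷ʳ; map-++)
open import Data.List.Relation.Unary.All using (All; []; _∷_) renaming (map to All-map)
open import Data.List.Relation.Unary.All.Properties using (all-filter)
open import Data.Product using (_×_; _,_; ∃; proj₁; proj₂)
open import Data.Sum using (_⊎_; inj₁; inj₂)
open import Function.Base using (_∘_)
open import Function.Bundles using (_⇔_; mk⇔; module Equivalence)
open import Relation.Nullary using (Dec; yes; no; ¬_; contradiction)
open import Relation.Binary using (tri<; tri≈; tri>)
open import Relation.Binary.PropositionalEquality using (_≡_; _≢_; refl; sym; trans; cong; cong₂; subst; module ≡-Reasoning)

open +-*-Solver using (solve; _:+_; _:*_; _:=_; con)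

𝟙 : {A : Set} → Dec A → ℕ
𝟙 (yes _) = 1
𝟙 (no _)  = 0

𝟙-yes : {A : Set} → A → (a : Dec A) → 𝟙 a ≡ 1
𝟙-yes x (yes _) = refl
𝟙-yes x (no ¬x) = contradiction x ¬x

𝟙-no : {A : Set} → ¬ A → (a : Dec A) → 𝟙 a ≡ 0
𝟙-no ¬x (yes x) = contradiction x ¬x
𝟙-no ¬x (no _)  = refl

𝟙-cong : {A B : Set} → (A → B) → (B → A) → (a : Dec A) (b : Dec B) → 𝟙 a ≡ 𝟙 b
𝟙-cong f g (yes x) b = sym (𝟙-yes (f x) b)
𝟙-cong f g (no ¬x) b = sym (𝟙-no (¬x ∘ g) b)

𝟙-trichotomy : ∀ a b → 𝟙 (a <? b) + 𝟙 (a ≟ b) + 𝟙 (b <? a) ≡ 1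
𝟙-trichotomy a b with <-cmp a b
... | tri< a<b a≢b a≯b rewrite 𝟙-yes a<b (a <? b) | 𝟙-no a≢b (a ≟ b) | 𝟙-no a≯b (b <? a) = refl
... | tri≈ a≮b a≡b a≯b rewrite 𝟙-no a≮b (a <? b) | 𝟙-yes a≡b (a ≟ b) | 𝟙-no a≯b (b <? a) = refl
... | tri> a≮b a≢b a>b rewrite 𝟙-no a≮b (a <? b) | 𝟙-no a≢b (a ≟ b) | 𝟙-yes a>b (b <? a) = refl

∑ : ℕ → (ℕ → ℕ) → ℕ
∑ zero    f = 0
∑ (suc n) f = ∑ n f + f (suc n)

syntax ∑ n (λ i → e) = ∑[ i ≤ n ] e

module _ {f g : ℕ → ℕ} where

  ∑-cong : ∀ n → (∀ {i} → 1 ≤ i → i ≤ n → f i ≡ g i) → ∑ n f ≡ ∑ n g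
  ∑-cong zero    f≡g = refl
  ∑-cong (suc n) f≡g = cong₂ _+_ (∑-cong n (λ 1≤i i≤n → f≡g 1≤i (m≤n⇒m≤1+n i≤n))) (f≡g (s≤s z≤n) ≤-refl)

  ∑-+ : ∀ n → ∑[ i ≤ n ] (f i + g i) ≡ ∑ n f + ∑ n g
  ∑-+ zero    = refl
  ∑-+ (suc n) = trans (cong (_+ (f (suc n) + g (suc n))) (∑-+ n))
                      (+-+-swap (∑ n f) (∑ n g) (f (suc n)) (g (suc n)))
    where
    +-+-swap : ∀ a b c d → (a + b) + (c + d) ≡ (a + c) + (b + d)
    +-+-swap = solve 4 (λ a b c d → (a :+ b) :+ (c :+ d) := (a :+ c) :+ (b :+ d)) refl

∑-+₃ : ∀ n (f g h : ℕ → ℕ) → ∑[ i ≤ n ] (f i + g i + h i) ≡ ∑ n f + ∑ n g + ∑ n h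
∑-+₃ n f g h = trans (∑-+ n) (cong (_+ ∑ n h) (∑-+ n))

∑-vanish : ∀ n {f : ℕ → ℕ} → (∀ {i} → 1 ≤ i → i ≤ n → f i ≡ 0) → ∑ n f ≡ 0
∑-vanish zero    f≡0 = refl
∑-vanish (suc n) f≡0 = cong₂ _+_ (∑-vanish n (λ 1≤i i≤n → f≡0 1≤i (m≤n⇒m≤1+n i≤n))) (f≡0 (s≤s z≤n) ≤-refl)

∑-swap : ∀ n m (f : ℕ → ℕ → ℕ) → ∑[ a ≤ n ] ∑[ b ≤ m ] f a b ≡ ∑[ b ≤ m ] ∑[ a ≤ n ] f a b
∑-swap zero    m f = sym (∑-vanish m (λ _ _ → refl))
∑-swap (suc n) m f = trans (cong (_+ ∑ m (f (suc n))) (∑-swap n m f)) (sym (∑-+ m))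

∑-δ : ∀ n (f : ℕ → ℕ) {a} → 1 ≤ a → a ≤ n → ∑[ b ≤ n ] (f b * 𝟙 (a ≟ b)) ≡ f a
∑-δ zero    f (s≤s _) ()
∑-δ (suc n) f {a} 1≤a a≤1+n with a ≟ suc n
... | yes refl = trans (cong (_+ f (suc n) * 1) lower≡0) (*-identityʳ (f (suc n)))
  where
  lower≡0 : ∑[ b ≤ n ] (f b * 𝟙 (suc n ≟ b)) ≡ 0
  lower≡0 = ∑-vanish n (λ {b} _ b≤n →
    trans (cong (f b *_) (𝟙-no (λ 1+n≡b → <⇒≢ (s≤s b≤n) (sym 1+n≡b)) (suc n ≟ b))) (*-zeroʳ (f b)))
... | no a≢1+n with m≤n⇒m<n∨m≡n a≤1+n
...   | inj₂ a≡1+n      = contradiction a≡1+n a≢1+n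
...   | inj₁ (s≤s a≤n) = trans (cong₂ _+_ (∑-δ n f 1≤a a≤n) (*-zeroʳ (f (suc n)))) (+-identityʳ (f a))

∑-δ-const : ∀ n {a} → 1 ≤ a → a ≤ n → ∑[ b ≤ n ] 𝟙 (a ≟ b) ≡ 1
∑-δ-const n {a} 1≤a a≤n =
  trans (∑-cong n (λ {b} _ _ → sym (*-identityˡ (𝟙 (a ≟ b))))) (∑-δ n (λ _ → 1) 1≤a a≤n)

∑-𝟙-witness : ∀ {P : ℕ → Set} (P? : ∀ i → Dec (P i)) n → ∑[ i ≤ n ] 𝟙 (P? i) ≢ 0 → ∃ P
∑-𝟙-witness P? zero    ∑≢0 = contradiction refl ∑≢0
∑-𝟙-witness P? (suc n) ∑≢0 with P? (suc n)
... | yes p = suc n , p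
... | no _  = ∑-𝟙-witness P? n (∑≢0 ∘ trans (+-identityʳ _))

∑∑-symmetric : ∀ n (f : ℕ → ℕ → ℕ) → (∀ a b → f a b ≡ f b a) →
  ∑[ a ≤ n ] ∑[ b ≤ n ] f a b ≡ ∑[ a ≤ n ] f a a + 2 * ∑[ a ≤ n ] ∑[ b ≤ n ] (f a b * 𝟙 (a <? b))
∑∑-symmetric n f f-sym = begin
  ∑[ a ≤ n ] ∑[ b ≤ n ] f a b
    ≡⟨ ∑-cong n (λ _ _ → ∑-cong n (λ _ _ → split _ _)) ⟩
  ∑[ a ≤ n ] ∑[ b ≤ n ] (L a b + M a b + G a b)
    ≡⟨ ∑-cong n (λ _ _ → ∑-+₃ n _ _ _) ⟩
  ∑[ a ≤ n ] (∑ n (L a) + ∑ n (M a) + ∑ n (G a))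
    ≡⟨ ∑-+₃ n _ _ _ ⟩
  ∑∑L + ∑[ a ≤ n ] ∑ n (M a) + ∑[ a ≤ n ] ∑ n (G a)
    ≡⟨ cong₂ (λ u v → ∑∑L + u + v) ∑∑M≡diagonal ∑∑G≡∑∑L ⟩
  ∑∑L + ∑[ a ≤ n ] f a a + ∑∑L
    ≡⟨ rearrange ∑∑L (∑[ a ≤ n ] f a a) ⟩
  ∑[ a ≤ n ] f a a + 2 * ∑∑L ∎
  where
  open ≡-Reasoning
  L M G : ℕ → ℕ → ℕ
  L a b = f a b * 𝟙 (a <? b)
  M a b = f a b * 𝟙 (a ≟ b)
  G a b = f a b * 𝟙 (b <? a)

  ∑∑L : ℕ
  ∑∑L = ∑[ a ≤ n ] ∑ n (L a)

  split : ∀ a b → f a b ≡ L a b + M a b + G a b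
  split a b = begin
    f a b                                            ≡⟨ sym (*-identityʳ (f a b)) ⟩
    f a b * 1                                        ≡⟨ cong (f a b *_) (sym (𝟙-trichotomy a b)) ⟩
    f a b * (𝟙 (a <? b) + 𝟙 (a ≟ b) + 𝟙 (b <? a))    ≡⟨ *-distribˡ-+ (f a b) _ _ ⟩
    f a b * (𝟙 (a <? b) + 𝟙 (a ≟ b)) + G a b         ≡⟨ cong (_+ G a b) (*-distribˡ-+ (f a b) _ _) ⟩
    L a b + M a b + G a b                            ∎

  ∑∑M≡diagonal : ∑[ a ≤ n ] ∑ n (M a) ≡ ∑[ a ≤ n ] f a a
  ∑∑M≡diagonal = ∑-cong n (∑-δ n (f _))

  ∑∑G≡∑∑L : ∑[ a ≤ n ] ∑ n (G a) ≡ ∑∑L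
  ∑∑G≡∑∑L = trans (∑-swap n n G)
    (∑-cong n (λ _ _ → ∑-cong n (λ _ _ → cong (_* 𝟙 (_ <? _)) (f-sym _ _))))

  rearrange : ∀ x d → x + d + x ≡ d + 2 * x
  rearrange = solve 2 (λ x d → x :+ d :+ x := d :+ con 2 :* x) refl

∑∑-symmetric-%2 : ∀ n (f : ℕ → ℕ → ℕ) → (∀ a b → f a b ≡ f b a) →
  (∑[ a ≤ n ] ∑[ b ≤ n ] f a b) % 2 ≡ (∑[ a ≤ n ] f a a) % 2
∑∑-symmetric-%2 n f f-sym = begin
  (∑[ a ≤ n ] ∑[ b ≤ n ] f a b) % 2 ≡⟨ cong (_% 2) (∑∑-symmetric n f f-sym) ⟩
  (diagonal + 2 * ∑∑L) % 2          ≡⟨ cong (λ x → (diagonal + x) % 2) (*-comm 2 ∑∑L) ⟩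
  (diagonal + ∑∑L * 2) % 2          ≡⟨ [m+kn]%n≡m%n diagonal ∑∑L 2 ⟩
  diagonal % 2                      ∎
  where
  open ≡-Reasoning
  diagonal ∑∑L : ℕ
  diagonal = ∑[ a ≤ n ] f a a
  ∑∑L = ∑[ a ≤ n ] ∑[ b ≤ n ] (f a b * 𝟙 (a <? b))

sum-map-applyUpTo : ∀ (f : ℕ → ℕ) n → sum (map f (applyUpTo suc n)) ≡ ∑ n f
sum-map-applyUpTo f zero    = refl
sum-map-applyUpTo f (suc n) = begin
  sum (map f (applyUpTo suc (suc n)))              ≡⟨ cong (sum ∘ map f) (sym (applyUpTo-∷ʳ suc n)) ⟩
  sum (map f (applyUpTo suc n ++ [ suc n ]))       ≡⟨ cong sum (map-++ f (applyUpTo suc n) [ suc n ]) ⟩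
  sum (map f (applyUpTo suc n) ++ [ f (suc n) ])   ≡⟨ sum-++ (map f (applyUpTo suc n)) [ f (suc n) ] ⟩
  sum (map f (applyUpTo suc n)) + (f (suc n) + 0)  ≡⟨ cong₂ _+_ (sum-map-applyUpTo f n) (+-identityʳ (f (suc n))) ⟩
  ∑ (suc n) f                                      ∎
  where open ≡-Reasoning

length-filter≡sum-𝟙 : ∀ {P : ℕ → Set} (P? : ∀ x → Dec (P x)) xs →
  length (filter P? xs) ≡ sum (map (𝟙 ∘ P?) xs)
length-filter≡sum-𝟙 P? []       = refl
length-filter≡sum-𝟙 P? (x ∷ xs) with P? x
... | yes _ = cong suc (length-filter≡sum-𝟙 P? xs)
... | no _  = length-filter≡sum-𝟙 P? xs

divisors : ℕ → List ℕ
divisors n = filter (_∣? n) (map suc (upTo n))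

τ : ℕ → ℕ
τ n = ∑[ d ≤ n ] 𝟙 (d ∣? n)

length-divisors : ∀ n → length (divisors n) ≡ τ n
length-divisors n = begin
  length (divisors n)                                   ≡⟨ length-filter≡sum-𝟙 (_∣? n) (map suc (upTo n)) ⟩
  sum (map (𝟙 ∘ (_∣? n)) (map suc (upTo n)))            ≡⟨ cong (sum ∘ map (𝟙 ∘ (_∣? n))) (map-upTo suc n) ⟩
  sum (map (𝟙 ∘ (_∣? n)) (applyUpTo suc n))             ≡⟨ sum-map-applyUpTo (𝟙 ∘ (_∣? n)) n ⟩
  τ n                                                   ∎
  where open ≡-Reasoning

factor-range : ∀ m n → 0 < m * n → 1 ≤ m × m ≤ m * n
factor-range zero    n       ()
factor-range (suc m) zero    m*0>0 = contradiction (subst (0 <_) (*-zeroʳ (suc m)) m*0>0) (λ ())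
factor-range (suc m) (suc n) _     = s≤s z≤n , m≤m*n (suc m) (suc n)

∑-𝟙-product≡𝟙-∣ : ∀ {N} → 0 < N → ∀ a → ∑[ b ≤ N ] 𝟙 (a * b ≟ N) ≡ 𝟙 (a ∣? N)
∑-𝟙-product≡𝟙-∣ {N} N>0 a with a ∣? N
... | no a∤N = ∑-vanish N (λ {b} _ _ → 𝟙-no (λ ab≡N → a∤N (divides b (trans (sym ab≡N) (*-comm a b)))) _)
... | yes (divides q N≡qa) =
  trans (∑-cong N (λ {b} _ _ → 𝟙-cong ab≡N⇒q≡b q≡b⇒ab≡N (a * b ≟ N) (q ≟ b))) (∑-δ-const N 1≤q q≤N)
  where
  qa>0 : 0 < q * a
  qa>0 = subst (0 <_) N≡qa N>0

  1≤q : 1 ≤ q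
  1≤q = proj₁ (factor-range q a qa>0)

  q≤N : q ≤ N
  q≤N = subst (q ≤_) (sym N≡qa) (proj₂ (factor-range q a qa>0))

  ab≡N⇒q≡b : ∀ {b} → a * b ≡ N → q ≡ b
  ab≡N⇒q≡b {b} ab≡N = *-cancelˡ-≡ q b a {{m*n≢0⇒n≢0 q {{>-nonZero qa>0}}}}
    (trans (*-comm a q) (trans (sym N≡qa) (sym ab≡N)))

  q≡b⇒ab≡N : ∀ {b} → q ≡ b → a * b ≡ N
  q≡b⇒ab≡N refl = trans (*-comm a q) (sym N≡qa)

squareRootCount : ℕ → ℕ
squareRootCount N = ∑[ a ≤ N ] 𝟙 (a * a ≟ N)

τ≡squareRootCount-%2 : ∀ {N} → 0 < N → τ N % 2 ≡ squareRootCount N % 2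
τ≡squareRootCount-%2 {N} N>0 = begin
  τ N % 2                                    ≡⟨ cong (_% 2) (∑-cong N (λ {a} _ _ → sym (∑-𝟙-product≡𝟙-∣ N>0 a))) ⟩
  (∑[ a ≤ N ] ∑[ b ≤ N ] 𝟙 (a * b ≟ N)) % 2  ≡⟨ ∑∑-symmetric-%2 N (λ a b → 𝟙 (a * b ≟ N)) product-sym ⟩
  squareRootCount N % 2                      ∎
  where
  open ≡-Reasoning
  product-sym : ∀ a b → 𝟙 (a * b ≟ N) ≡ 𝟙 (b * a ≟ N)
  product-sym a b = cong (λ x → 𝟙 (x ≟ N)) (*-comm a b)

m*m≡n*n⇒m≡n : ∀ m n → m * m ≡ n * n → m ≡ n
m*m≡n*n⇒m≡n m n mm≡nn with <-cmp m n
... | tri< m<n _ _ = contradiction mm≡nn (<⇒≢ (*-mono-< m<n m<n))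
... | tri≈ _ m≡n _ = m≡n
... | tri> _ _ m>n = contradiction (sym mm≡nn) (<⇒≢ (*-mono-< m>n m>n))

square⇒squareRootCount≡1 : ∀ {N} → 0 < N → IsSquare N → squareRootCount N ≡ 1
square⇒squareRootCount≡1 {N} N>0 (m , N≡mm) with factor-range m m (subst (0 <_) N≡mm N>0)
... | 1≤m , m≤mm = trans (∑-cong N (λ {a} _ _ → 𝟙-cong aa≡N⇒m≡a m≡a⇒aa≡N (a * a ≟ N) (m ≟ a)))
                         (∑-δ-const N 1≤m (subst (m ≤_) (sym N≡mm) m≤mm))
  where
  aa≡N⇒m≡a : ∀ {a} → a * a ≡ N → m ≡ a
  aa≡N⇒m≡a {a} aa≡N = m*m≡n*n⇒m≡n m a (trans (sym N≡mm) (sym aa≡N))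

  m≡a⇒aa≡N : ∀ {a} → m ≡ a → a * a ≡ N
  m≡a⇒aa≡N refl = sym N≡mm

squareRootCount≢0⇒square : ∀ N → squareRootCount N ≢ 0 → IsSquare N
squareRootCount≢0⇒square N count≢0 with ∑-𝟙-witness (λ a → a * a ≟ N) N count≢0
... | a , aa≡N = a , sym aa≡N

%2≡0⊎%2≡1 : ∀ x → x % 2 ≡ 0 ⊎ x % 2 ≡ 1
%2≡0⊎%2≡1 x with x % 2 | m%n<n x 2
... | 0           | _                 = inj₁ refl
... | 1           | _                 = inj₂ refl
... | suc (suc _) | s≤s (s≤s ())

odd⇒%2≡1 : ∀ {n} → Odd n → n % 2 ≡ 1
odd⇒%2≡1 (m , refl) = trans (cong (_% 2) (2m+1≡1+m*2 m)) ([m+kn]%n≡m%n 1 m 2)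
  where
  2m+1≡1+m*2 : ∀ m → 2 * m + 1 ≡ 1 + m * 2
  2m+1≡1+m*2 = solve 1 (λ m → con 2 :* m :+ con 1 := con 1 :+ m :* con 2) refl

%2≡1⇒odd : ∀ {n} → n % 2 ≡ 1 → Odd n
%2≡1⇒odd {n} n%2≡1 = n / 2 , (begin
  n                      ≡⟨ m≡m%n+[m/n]*n n 2 ⟩
  n % 2 + n / 2 * 2      ≡⟨ cong (_+ n / 2 * 2) n%2≡1 ⟩
  1 + n / 2 * 2          ≡⟨ 1+m*2≡2m+1 (n / 2) ⟩
  2 * (n / 2) + 1        ∎)
  where
  open ≡-Reasoning
  1+m*2≡2m+1 : ∀ m → 1 + m * 2 ≡ 2 * m + 1
  1+m*2≡2m+1 = solve 1 (λ m → con 1 :+ m :* con 2 := con 2 :* m :+ con 1) refl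

∣-odd : ∀ {d n} → n % 2 ≡ 1 → d ∣ n → d % 2 ≡ 1
∣-odd {d} {n} n%2≡1 d∣n with %2≡0⊎%2≡1 d
... | inj₂ d%2≡1 = d%2≡1
... | inj₁ d%2≡0 = contradiction (trans (sym (n∣m⇒m%n≡0 n 2 2∣n)) n%2≡1) 0≢1+n
  where
  2∣n : 2 ∣ n
  2∣n = ∣-trans (m%n≡0⇒n∣m d 2 d%2≡0) d∣n

sum-odd-%2 : ∀ {xs} → All (λ x → x % 2 ≡ 1) xs → sum xs % 2 ≡ length xs % 2
sum-odd-%2 []                       = refl
sum-odd-%2 {x ∷ xs} (x%2≡1 ∷ xs-odd) = begin
  (x + sum xs) % 2             ≡⟨ %-distribˡ-+ x (sum xs) 2 ⟩
  (x % 2 + sum xs % 2) % 2     ≡⟨ cong₂ (λ u v → (u + v) % 2) x%2≡1 (sum-odd-%2 xs-odd) ⟩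
  (1 + length xs % 2) % 2      ≡⟨ sym (%-distribˡ-+ 1 (length xs) 2) ⟩
  suc (length xs) % 2          ∎
  where open ≡-Reasoning

+-even-%2 : ∀ a b → (a + b) % 2 ≡ 0 → a % 2 ≡ 1 → b % 2 ≡ 1
+-even-%2 a b a+b-even a%2≡1 with %2≡0⊎%2≡1 b
... | inj₂ b%2≡1 = b%2≡1
... | inj₁ b%2≡0 = contradiction
  (trans (sym a+b-even) (trans (%-distribˡ-+ a b 2) (cong₂ (λ u v → (u + v) % 2) a%2≡1 b%2≡0)))
  (λ ())

σ≡τ-%2 : ∀ n → n % 2 ≡ 1 → σ n % 2 ≡ τ n % 2
σ≡τ-%2 n n%2≡1 = trans (sum-odd-%2 divisors-odd) (cong (_% 2) (length-divisors n))
  where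
  divisors-odd : All (λ d → d % 2 ≡ 1) (divisors n)
  divisors-odd = All-map (∣-odd n%2≡1) (all-filter (_∣? n) (map suc (upTo n)))

odd-deficient-perfect-square⇔odd : ∀ {n k} → 0 < n → Odd n → ExactlyDeficientPerfect k n → IsSquare n ⇔ Odd k
odd-deficient-perfect-square⇔odd {n} {k} n>0 n-odd (ds , length≡k , _ , proper , σ+∑ds≡2n) =
  mk⇔ square⇒k-odd k-odd⇒square
  where
  open ≡-Reasoning
  n%2≡1 : n % 2 ≡ 1
  n%2≡1 = odd⇒%2≡1 n-odd

  ∑ds≡k-%2 : sum ds % 2 ≡ k % 2
  ∑ds≡k-%2 = trans (sum-odd-%2 (All-map (λ (_ , d∣n , _) → ∣-odd n%2≡1 d∣n) proper)) (cong (_% 2) length≡k)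

  σ≡roots-%2 : σ n % 2 ≡ squareRootCount n % 2
  σ≡roots-%2 = trans (σ≡τ-%2 n n%2≡1) (τ≡squareRootCount-%2 n>0)

  roots+k-even : (squareRootCount n + k) % 2 ≡ 0
  roots+k-even = begin
    (squareRootCount n + k) % 2                ≡⟨ %-distribˡ-+ (squareRootCount n) k 2 ⟩
    (squareRootCount n % 2 + k % 2) % 2        ≡⟨ cong₂ (λ u v → (u + v) % 2) (sym σ≡roots-%2) (sym ∑ds≡k-%2) ⟩
    (σ n % 2 + sum ds % 2) % 2                 ≡⟨ sym (%-distribˡ-+ (σ n) (sum ds) 2) ⟩
    (σ n + sum ds) % 2                         ≡⟨ cong (_% 2) (trans σ+∑ds≡2n (*-comm 2 n)) ⟩
    (n * 2) % 2                                ≡⟨ m*n%n≡0 n 2 ⟩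
    0                                          ∎

  square⇒k-odd : IsSquare n → Odd k
  square⇒k-odd square = %2≡1⇒odd (+-even-%2 1 k 1+k-even refl)
    where
    1+k-even : (1 + k) % 2 ≡ 0
    1+k-even = subst (λ r → (r + k) % 2 ≡ 0) (square⇒squareRootCount≡1 n>0 square) roots+k-even

  k-odd⇒square : Odd k → IsSquare n
  k-odd⇒square k-odd = squareRootCount≢0⇒square n roots≢0
    where
    roots-odd : squareRootCount n % 2 ≡ 1
    roots-odd = +-even-%2 k (squareRootCount n)
      (trans (cong (_% 2) (+-comm k (squareRootCount n))) roots+k-even) (odd⇒%2≡1 k-odd)

    roots≢0 : squareRootCount n ≢ 0
    roots≢0 roots≡0 = contradiction (trans (sym roots-odd) (cong (_% 2) roots≡0)) (λ ())

lemma1 : ((n k : ℕ) → 0 < n → 0 < k → Odd n → ExactlyDeficientPerfect k n →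
    (IsSquare n ⇔ Odd k))
    × ((n : ℕ) → 0 < n → Odd n → ExactlyDeficientPerfect 3 n → IsSquare n)
lemma1 = (λ n k n>0 _ → odd-deficient-perfect-square⇔odd n>0)
       , (λ n n>0 n-odd dp → Equivalence.from (odd-deficient-perfect-square⇔odd n>0 n-odd dp) (1 , refl))
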